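{- Let $u\le w$ in $\mathbb{P}^*$ with $|u|=|w|$, let $m_i=w(i)-u(i)$ and let $M_{uw}$ be the multiset $\{\{1^{m_1},2^{m_2},\dots\}\}$ (each $i$ repeated $m_i$ times). Then the label function $C\mapsto l(C)$ is a bijection between the maximal chains of $[u,w]$ and the permutations (rearrangements) of $M_{uw}$. In particular, if $M_{uw}$ contains only one distinct element (possibly with multiplicity), then $[u,w]$ contains a unique maximal chain.
   Context: $\mathbb{P}^*$ is the set of finite words over the positive integers, with $u\le w$ iff $w$ has a subword $w(i_1)\cdots w(i_l)$ ($i_1<\dots<i_l$, $l=|u|$) with $u(j)\le w(i_j)$ for all $j$. In this poset $x$ covers $y$ iff $y$ is obtained from $x$ by decreasing one entry by $1$ (deleting it if it becomes $0$). An expansion of a word is a word over the nonnegative integers whose restriction to its nonzero positions equals that word. Labels of a maximal chain $C: w=v_0\gtrdot v_1\gtrdot\cdots\gtrdot v_d=u$: set $\eta_{v_0}=w$; for $j\ge1$, $\eta_{v_j}$ is the expansion of $v_j$ obtained from $\eta_{v_{j-1}}$ by subtracting $1$ from a single position $i$ (with $\eta_{v_{j-1}}(i)\ge1$), where, if the decreased entry goes from $1$ to $0$, $i$ is chosen to be the position of the first (leftmost) $1$ of the run (maximal block of consecutive equal letters) of $1$'s of $v_{j-1}$ containing the deleted entry; this makes $\eta_{v_j}$ unique. The label of the edge $v_{j-1}\gtrdot v_j$ is $l_j=i$, and $l(C)=(l_1,\dots,l_d)$. -}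

module Defs where

open import Data.Nat using (ℕ; zero; suc; _≤_; _<_; _∸_; _≡ᵇ_)
open import Data.Bool using (Bool; true; false; _∧_; not; if_then_else_)
open import Data.List using (List; []; _∷_; _++_; replicate; take; length; last; upTo; findᵇ)
open import Data.List.Properties using (≡-dec)
open import Data.List.Relation.Unary.All using (All)
open import Data.Maybe using (Maybe; just; nothing)
open import Data.Product using (_×_; _,_; Σ)
open import Data.Sum using (_⊎_)
open import Relation.Nullary using (¬_)
open import Relation.Nullary.Decidable using (⌊_⌋)
open import Relation.Binary.PropositionalEquality using (_≡_)
import Data.Nat as ℕ

Word : List ℕ → Set
Word = All (λ a → 0 < a)

-- The order on ℙ*: u ≼ w iff w has a subword w(i₁)…w(iₗ) (l = |u|)
-- with u(j) ≤ w(iⱼ) for all j.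
data _≼_ : List ℕ → List ℕ → Set where
  nil  : ∀ {w} → [] ≼ w
  keep : ∀ {a b u w} → a ≤ b → u ≼ w → (a ∷ u) ≼ (b ∷ w)
  skip : ∀ {b u w} → u ≼ w → u ≼ (b ∷ w)

_⋗_ : List ℕ → List ℕ → Set
x ⋗ y = Word x × Word y × y ≼ x × ¬ (y ≡ x)
        × (∀ z → Word z → y ≼ z → z ≼ x → z ≡ y ⊎ z ≡ x)

data CoverSeq : List (List ℕ) → Set where
  one  : ∀ {x} → Word x → CoverSeq (x ∷ [])
  step : ∀ {x y vs} → x ⋗ y → CoverSeq (y ∷ vs) → CoverSeq (x ∷ y ∷ vs)

record MaxChain (u w : List ℕ) : Set where
  field
    elems  : List (List ℕ)
    covers : CoverSeq elems
    top    : Data.List.head elems ≡ just w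
    bottom : last elems ≡ just u
open MaxChain public

nz : List ℕ → List ℕ
nz []            = []
nz (zero  ∷ xs)  = nz xs
nz (suc a ∷ xs)  = suc a ∷ nz xs

entryAt : List ℕ → ℕ → Maybe ℕ
entryAt []       _       = nothing
entryAt (x ∷ xs) zero    = just x
entryAt (x ∷ xs) (suc i) = entryAt xs i

decAt : List ℕ → ℕ → List ℕ
decAt []       _       = []
decAt (x ∷ xs) zero    = (x ∸ 1) ∷ xs
decAt (x ∷ xs) (suc i) = x ∷ decAt xs i

eqL : List ℕ → List ℕ → Bool
eqL xs ys = ⌊ ≡-dec ℕ._≟_ xs ys ⌋

isJust1 : Maybe ℕ → Bool
isJust1 (just 1) = true
isJust1 _        = false

-- Is (0-based) position i of the expansion η a valid choice for passing
-- from η (an expansion of v_{j-1} = nz η) to an expansion of v'?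
-- Conditions: η(i) ≥ 1; nz (η with η(i) decreased) = v'; and if η(i) = 1
-- (the entry is deleted), i is the first 1 of its run of 1's in v_{j-1},
-- i.e. the nearest nonzero entry of η to the left of i is not 1.
validPos : List ℕ → List ℕ → ℕ → Bool
validPos η v' i with entryAt η i
... | nothing      = false
... | just zero    = false
... | just (suc e) =
      eqL (nz (decAt η i)) v'
      ∧ (if e ≡ᵇ 0 then not (isJust1 (last (nz (take i η)))) else true)

labelStep : List ℕ → List ℕ → Maybe (ℕ × List ℕ)
labelStep η v' with findᵇ (validPos η v') (upTo (length η))
... | nothing = nothing
... | just i  = just (suc i , decAt η i)

labelsFrom : List ℕ → List (List ℕ) → Maybe (List ℕ)
labelsFrom η []         = just []
labelsFrom η (v' ∷ vs) with labelStep η v'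
... | nothing       = nothing
... | just (i , η') with labelsFrom η' vs
...   | nothing = nothing
...   | just ls = just (i ∷ ls)

chainLabels : ∀ {u w} → MaxChain u w → Maybe (List ℕ)
chainLabels C with elems C
... | []       = nothing
... | (x ∷ vs) = labelsFrom x vs

multisetFrom : ℕ → List ℕ → List ℕ → List ℕ
multisetFrom k (a ∷ u) (b ∷ w) = replicate (b ∸ a) k ++ multisetFrom (suc k) u w
multisetFrom k _       _       = []

M : List ℕ → List ℕ → List ℕ
M u w = multisetFrom 1 u w

{-# OPTIONS --safe #-}
-- Since |u| = |w|, the interval [u, w] is the product order on words of that length, so a cover
-- decrements a single entry that stays ≥ 1. No entry is ever deleted, the run-of-ones rule of the
-- labelling never fires, and the edge x ⋗ decAt x i is labelled i + 1. Descending from w to u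
-- thus decrements position i exactly w(i) − u(i) times, so the labels rearrange M u w; conversely
-- every rearrangement can be carried out step by step, and replaying the labels from w recovers
-- the chain.
module Submission where

open import Defs
open import Data.Bool using (Bool; true; false; _∧_)
open import Data.Bool.Properties using (T-≡)
open import Data.Empty using (⊥-elim)
open import Data.List using (List; []; _∷_; _++_; length; replicate; last; applyUpTo; findᵇ)
open import Data.List.Properties using (∷-injective)
open import Data.List.Membership.Propositional using (_∈_)
open import Data.List.Membership.Propositional.Properties using (∈-++⁻)
open import Data.List.Relation.Binary.Permutation.Propositional
  using (_↭_; ↭-refl; ↭-sym; ↭-trans; ↭-prep; ↭-reflexive; module PermutationReasoning)
open import Data.List.Relation.Binary.Permutation.Propositional.Properties
  using (↭-empty-inv; ↭-length; All-resp-↭; ∈-resp-↭; shift; drop-∷; ++⁺ˡ)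
open import Data.List.Relation.Binary.Pointwise as Pointwise using (Pointwise; []; _∷_)
open import Data.List.Relation.Unary.All using (All; []; _∷_)
open import Data.List.Relation.Unary.Any using (here; there)
open import Data.Maybe using (just)
open import Data.Nat using (ℕ; zero; suc; pred; _+_; _∸_; _≤_; _<_; z≤n; s≤s)
open import Data.Nat.Properties
  using ( ≤-refl; ≤-trans; ≤-antisym; ≤-reflexive
        ; m≤n⇒m≤1+n; 1+n≰n; 1+n≢n; suc-injective; <⇒≢; m≤n⇒m<n∨m≡n; m∸n≤m; ∸-monoˡ-≤; n∸n≡0
        ; m∸n≡0⇒m≤n; +-∸-assoc; +-identityʳ; +-suc)
open import Data.Product using (Σ; _×_; _,_; proj₁; proj₂)
open import Data.Sum using (_⊎_; inj₁; inj₂; [_,_]′)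
open import Function.Bundles using (Equivalence)
open import Relation.Binary.PropositionalEquality using (_≡_; _≢_; refl; sym; trans; cong; cong₂)
open import Relation.Nullary.Decidable using (toWitness; fromWitness)

private
  variable
    a b c i j k l : ℕ
    u w x y z : List ℕ
    vs : List (List ℕ)

squeeze-≡ : a ≤ b → b ≤ c → a ≡ c → a ≡ b
squeeze-≡ a≤b b≤c refl = ≤-antisym a≤b b≤c

infix 4 _≤*_

_≤*_ : List ℕ → List ℕ → Set
_≤*_ = Pointwise _≤_

≤*-refl : x ≤* x
≤*-refl = Pointwise.refl ≤-refl

≤*-antisym : x ≤* y → y ≤* x → x ≡ y
≤*-antisym p q = Pointwise.Pointwise-≡⇒≡ (Pointwise.antisymmetric ≤-antisym p q)

≼-length : x ≼ y → length x ≤ length y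
≼-length nil        = z≤n
≼-length (keep _ p) = s≤s (≼-length p)
≼-length (skip p)   = m≤n⇒m≤1+n (≼-length p)

≼-trans : x ≼ y → y ≼ z → x ≼ z
≼-trans nil          _            = nil
≼-trans p            (skip q)     = skip (≼-trans p q)
≼-trans (keep p₁ p₂) (keep q₁ q₂) = keep (≤-trans p₁ q₁) (≼-trans p₂ q₂)
≼-trans (skip p)     (keep _ q)   = skip (≼-trans p q)

≤*⇒≼ : x ≤* y → x ≼ y
≤*⇒≼ []       = nil
≤*⇒≼ (p ∷ ps) = keep p (≤*⇒≼ ps)

≼-refl : x ≼ x
≼-refl = ≤*⇒≼ ≤*-refl

≼⇒≤* : x ≼ y → length x ≡ length y → x ≤* y
≼⇒≤* {[]} {[]}    nil        _ = []
≼⇒≤* {[]} {_ ∷ _} nil        ()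
≼⇒≤* (keep p q) e = p ∷ ≼⇒≤* q (suc-injective e)
≼⇒≤* (skip q)   e = ⊥-elim (1+n≰n (≤-trans (≤-reflexive (sym e)) (≼-length q)))

data Reducible : List ℕ → ℕ → Set where
  here  : 2 ≤ a → Reducible (a ∷ x) zero
  there : Reducible x i → Reducible (a ∷ x) (suc i)

data Gap : List ℕ → List ℕ → ℕ → Set where
  here  : a < b → Gap (a ∷ u) (b ∷ x) zero
  there : Gap u x i → Gap (a ∷ u) (b ∷ x) (suc i)

reducible⇒entryAt : Reducible x i → Σ ℕ (λ e → entryAt x i ≡ just (suc (suc e)))
reducible⇒entryAt (here (s≤s (s≤s {n = e} _))) = e , refl
reducible⇒entryAt (there r)                     = reducible⇒entryAt r

entryAt⇒reducible : ∀ x i → entryAt x i ≡ just (suc (suc a)) → Reducible x i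
entryAt⇒reducible (_ ∷ _) zero    refl = here (s≤s (s≤s z≤n))
entryAt⇒reducible (_ ∷ x) (suc i) e    = there (entryAt⇒reducible x i e)

reducible⇒< : Reducible x i → i < length x
reducible⇒< (here _)  = s≤s z≤n
reducible⇒< (there r) = s≤s (reducible⇒< r)

gap⇒reducible : Word y → Gap y x i → Reducible x i
gap⇒reducible (p ∷ _)  (here lt) = here (≤-trans (s≤s p) lt)
gap⇒reducible (_ ∷ wy) (there g) = there (gap⇒reducible wy g)

≢⇒gap : y ≤* x → y ≢ x → Σ ℕ (Gap y x)
≢⇒gap [] y≢x = ⊥-elim (y≢x refl)
≢⇒gap (p ∷ ps) y≢x with m≤n⇒m<n∨m≡n p
... | inj₁ lt   = zero , here lt
... | inj₂ refl with ≢⇒gap ps (λ e → y≢x (cong (_ ∷_) e))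
...   | i , g = suc i , there g

decAt-length : ∀ x i → length (decAt x i) ≡ length x
decAt-length []      _       = refl
decAt-length (_ ∷ _) zero    = refl
decAt-length (_ ∷ x) (suc i) = cong suc (decAt-length x i)

decAt-≤* : ∀ x i → decAt x i ≤* x
decAt-≤* []      _       = []
decAt-≤* (a ∷ _) zero    = m∸n≤m a 1 ∷ ≤*-refl
decAt-≤* (_ ∷ x) (suc i) = ≤-refl ∷ decAt-≤* x i

decAt-word : Word x → Reducible x i → Word (decAt x i)
decAt-word (_ ∷ wx) (here (s≤s (s≤s _))) = s≤s z≤n ∷ wx
decAt-word (p ∷ wx) (there r)             = p ∷ decAt-word wx r

decAt-≢ : Reducible x i → decAt x i ≢ x
decAt-≢ (here (s≤s (s≤s _))) e = 1+n≢n (sym (proj₁ (∷-injective e)))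
decAt-≢ (there r)            e = decAt-≢ r (proj₂ (∷-injective e))

decAt-injective : entryAt x j ≡ just (suc a) → Reducible x i → decAt x j ≡ decAt x i → j ≡ i
decAt-injective {j = zero}  _    (here _)             _ = refl
decAt-injective {j = zero}  refl (there _)            e = ⊥-elim (1+n≢n (sym (proj₁ (∷-injective e))))
decAt-injective {j = suc _} _    (here (s≤s (s≤s _))) e = ⊥-elim (1+n≢n (proj₁ (∷-injective e)))
decAt-injective {j = suc _} eq   (there r)            e = cong suc (decAt-injective eq r (proj₂ (∷-injective e)))

gap⇒≤*-decAt : y ≤* x → Gap y x i → y ≤* decAt x i
gap⇒≤*-decAt (_ ∷ ps) (here lt) = ∸-monoˡ-≤ 1 lt ∷ ps
gap⇒≤*-decAt (p ∷ ps) (there g) = p ∷ gap⇒≤*-decAt ps g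

≤*-decAt⇒gap : y ≤* decAt x i → Reducible x i → Gap y x i
≤*-decAt⇒gap (p ∷ _)  (here (s≤s (s≤s _))) = here (s≤s p)
≤*-decAt⇒gap (_ ∷ ps) (there r)             = there (≤*-decAt⇒gap ps r)

between-decAt : Reducible x i → decAt x i ≤* z → z ≤* x → z ≡ decAt x i ⊎ z ≡ x
between-decAt (here _) (p ∷ ps) (q ∷ qs) with ≤*-antisym qs ps | m≤n⇒m<n∨m≡n q
... | refl | inj₂ refl = inj₂ refl
... | refl | inj₁ lt   = inj₁ (cong (_∷ _) (≤-antisym (∸-monoˡ-≤ 1 lt) p))
between-decAt (there r) (p ∷ ps) (q ∷ qs) with ≤-antisym q p | between-decAt r ps qs
... | refl | inj₁ e = inj₁ (cong (_ ∷_) e)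
... | refl | inj₂ e = inj₂ (cong (_ ∷_) e)

cover⇒decAt : x ⋗ y → length y ≡ length x → Σ ℕ (λ i → Reducible x i × y ≡ decAt x i)
cover⇒decAt {x} (wx , wy , y≼x , y≢x , nothing-between) len =
  let y≤x   = ≼⇒≤* y≼x len
      i , g = ≢⇒gap y≤x y≢x
      r     = gap⇒reducible wy g
  in  i , r , [ sym , (λ e → ⊥-elim (decAt-≢ r e)) ]′
                 (nothing-between (decAt x i) (decAt-word wx r)
                    (≤*⇒≼ (gap⇒≤*-decAt y≤x g)) (≤*⇒≼ (decAt-≤* x i)))

decAt-cover : Word x → Reducible x i → x ⋗ decAt x i
decAt-cover {x} {i} wx r = wx , decAt-word wx r , ≤*⇒≼ (decAt-≤* x i) , decAt-≢ r , nothing-between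
  where
  nothing-between : ∀ z → Word z → decAt x i ≼ z → z ≼ x → z ≡ decAt x i ⊎ z ≡ x
  nothing-between z _ below above = between-decAt r (≼⇒≤* below len-below) (≼⇒≤* above len-above)
    where
    len-below : length (decAt x i) ≡ length z
    len-below = squeeze-≡ (≼-length below) (≼-length above) (decAt-length x i)
    len-above : length z ≡ length x
    len-above = trans (sym len-below) (decAt-length x i)

eqL-sound : ∀ x y → eqL x y ≡ true → x ≡ y
eqL-sound _ _ h = toWitness (Equivalence.from T-≡ h)

eqL-refl : ∀ x → eqL x x ≡ true
eqL-refl x = Equivalence.to T-≡ (fromWitness refl)

nz-word : Word x → nz x ≡ x
nz-word []             = refl
nz-word (s≤s z≤n ∷ wx) = cong (_ ∷_) (nz-word wx)

nz-length : ∀ x → length (nz x) ≤ length x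
nz-length []          = z≤n
nz-length (zero  ∷ x) = m≤n⇒m≤1+n (nz-length x)
nz-length (suc _ ∷ x) = s≤s (nz-length x)

nz-decAt-shorter : Word x → entryAt x j ≡ just 1 → length (nz (decAt x j)) < length x
nz-decAt-shorter {1 ∷ x}     {zero}  _        refl = s≤s (nz-length x)
nz-decAt-shorter {suc _ ∷ _} {suc _} (_ ∷ wx) e    = s≤s (nz-decAt-shorter wx e)

∧-trueˡ : ∀ {p q} → p ∧ q ≡ true → p ≡ true
∧-trueˡ {true} _ = refl

validPos-decAt : Word x → Reducible x i → validPos x (decAt x i) i ≡ true
validPos-decAt {x} {i} wx r with reducible⇒entryAt r
... | _ , eq rewrite eq | nz-word (decAt-word wx r) | eqL-refl (decAt x i) = refl

validPos-sound : ∀ x v j → validPos x v j ≡ true →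
  Σ ℕ (λ e → entryAt x j ≡ just (suc e) × nz (decAt x j) ≡ v)
validPos-sound x v j valid with entryAt x j
... | just (suc e) = e , refl , eqL-sound (nz (decAt x j)) v (∧-trueˡ valid)

validPos-unique : ∀ j → Word x → Reducible x i → validPos x (decAt x i) j ≡ true → j ≡ i
validPos-unique {x} {i} j wx r valid with validPos-sound x (decAt x i) j valid
... | zero  , eq , matches =
  ⊥-elim (<⇒≢ (nz-decAt-shorter wx eq) (trans (cong length matches) (decAt-length x i)))
... | suc _ , eq , matches =
  decAt-injective eq r (trans (sym (nz-word (decAt-word wx (entryAt⇒reducible x j eq)))) matches)

findᵇ-applyUpTo : ∀ {A : Set} (p : A → Bool) (f : ℕ → A) {i n} →
  p (f i) ≡ true → (∀ {j} → j < i → p (f j) ≡ false) → i < n → findᵇ p (applyUpTo f n) ≡ just (f i)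
findᵇ-applyUpTo p f {zero}  {suc _} hit _      _ rewrite hit = refl
findᵇ-applyUpTo p f {suc i} {suc _} hit before (s≤s i<n) rewrite before {zero} (s≤s z≤n) =
  findᵇ-applyUpTo p (λ k → f (suc k)) hit (λ j<i → before (s≤s j<i)) i<n

validPos-before : Word x → Reducible x i → j < i → validPos x (decAt x i) j ≡ false
validPos-before {x} {i} {j} wx r j<i with validPos x (decAt x i) j in valid
... | false = refl
... | true  = ⊥-elim (<⇒≢ j<i (validPos-unique j wx r valid))

labelStep-decAt : Word x → Reducible x i → labelStep x (decAt x i) ≡ just (suc i , decAt x i)
labelStep-decAt {x} {i} wx r
  rewrite findᵇ-applyUpTo (validPos x (decAt x i)) (λ k → k)
            (validPos-decAt wx r) (validPos-before wx r) (reducible⇒< r)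
  = refl

labelsFrom-∷ : ∀ {η η′ ls} → labelStep η y ≡ just (l , η′) → labelsFrom η′ vs ≡ just ls →
               labelsFrom η (y ∷ vs) ≡ just (l ∷ ls)
labelsFrom-∷ first rest rewrite first | rest = refl

multisetFrom-self : ∀ k x → multisetFrom k x x ≡ []
multisetFrom-self k []      = refl
multisetFrom-self k (a ∷ x) rewrite n∸n≡0 a = multisetFrom-self (suc k) x

multisetFrom-decAt : ∀ k → Gap u x i → multisetFrom k u x ↭ k + i ∷ multisetFrom k u (decAt x i)
multisetFrom-decAt k (here {b = suc _} (s≤s a≤b)) rewrite +-∸-assoc 1 a≤b | +-identityʳ k = ↭-refl
multisetFrom-decAt {u = a ∷ u} {x = b ∷ x} {i = suc i} k (there g) = begin
  ks ++ multisetFrom (suc k) u x          ↭⟨ ++⁺ˡ ks (multisetFrom-decAt (suc k) g) ⟩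
  ks ++ suc k + i ∷ rest                  ↭⟨ shift (suc k + i) ks rest ⟩
  suc k + i ∷ ks ++ rest                  ≡⟨ cong (_∷ ks ++ rest) (sym (+-suc k i)) ⟩
  k + suc i ∷ ks ++ rest                  ∎
  where
  open PermutationReasoning
  ks : List ℕ
  ks = replicate (b ∸ a) k
  rest : List ℕ
  rest = multisetFrom (suc k) u (decAt x i)

multisetFrom-≡[] : ∀ k → u ≤* x → multisetFrom k u x ≡ [] → u ≡ x
multisetFrom-≡[] k [] _ = refl
multisetFrom-≡[] k (_∷_ {a} {b} a≤b ps) empty with b ∸ a in eq
... | zero = cong₂ _∷_ (≤-antisym a≤b (m∸n≡0⇒m≤n eq)) (multisetFrom-≡[] (suc k) ps empty)

∈-replicate⁻ : ∀ n → l ∈ replicate n k → l ≡ k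
∈-replicate⁻ (suc n) (here l≡k)  = l≡k
∈-replicate⁻ (suc n) (there l∈) = ∈-replicate⁻ n l∈

∈-multisetFrom : ∀ k → u ≤* x → l ∈ multisetFrom k u x → Σ ℕ (λ i → l ≡ k + i × Gap u x i)
∈-multisetFrom k (_∷_ {a} {b} a≤b ps) l∈ with ∈-++⁻ (replicate (b ∸ a) k) l∈ | m≤n⇒m<n∨m≡n a≤b
... | inj₁ l∈rep | inj₁ a<b  = 0 , trans (∈-replicate⁻ (b ∸ a) l∈rep) (sym (+-identityʳ k)) , here a<b
... | inj₁ l∈rep | inj₂ refl rewrite n∸n≡0 a with () ← l∈rep
... | inj₂ l∈rest | _ with ∈-multisetFrom (suc k) ps l∈rest
...   | i , refl , g = suc i , sym (+-suc k i) , there g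

↭-All≡⇒≡ : ∀ {xs ys} → All (_≡ a) ys → xs ↭ ys → xs ≡ ys
↭-All≡⇒≡ {xs = xs} {ys} all≡ xs↭ys = go xs ys (All-resp-↭ (↭-sym xs↭ys) all≡) all≡ (↭-length xs↭ys)
  where
  go : ∀ xs ys → All (_≡ a) xs → All (_≡ a) ys → length xs ≡ length ys → xs ≡ ys
  go []       []       _            _            _   = refl
  go (_ ∷ xs) (_ ∷ ys) (refl ∷ pxs) (refl ∷ pys) len = cong (_ ∷_) (go xs ys pxs pys (suc-injective len))

coverSeq-≼ : CoverSeq (x ∷ vs) → last (x ∷ vs) ≡ just u → u ≼ x
coverSeq-≼ (one _)                       refl = ≼-refl
coverSeq-≼ (step (_ , _ , y≼x , _) rest) e    = ≼-trans (coverSeq-≼ rest e) y≼x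

-- Labels are 1-based, decAt positions 0-based.
replay : List ℕ → List ℕ → List (List ℕ)
replay x []       = []
replay x (l ∷ ls) = decAt x (pred l) ∷ replay (decAt x (pred l)) ls

coverSeq-labels : CoverSeq (x ∷ vs) → last (x ∷ vs) ≡ just u → length u ≡ length x →
  Σ (List ℕ) (λ ls → labelsFrom x vs ≡ just ls × ls ↭ M u x × vs ≡ replay x ls)
coverSeq-labels {x} (one _) refl _ = [] , refl , ↭-reflexive (sym (multisetFrom-self 1 x)) , refl
coverSeq-labels (step x⋗y@(wx , _ , y≼x , _) rest) e len
  with u≼y ← coverSeq-≼ rest e
  with len-uy ← squeeze-≡ (≼-length u≼y) (≼-length y≼x) len
  with (i , r , refl) ← cover⇒decAt x⋗y (trans (sym len-uy) len)
  with (ls , labels , ls↭ , chain) ← coverSeq-labels rest e len-uy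
  = suc i ∷ ls
  , labelsFrom-∷ (labelStep-decAt wx r) labels
  , ↭-trans (↭-prep (suc i) ls↭) (↭-sym (multisetFrom-decAt 1 (≤*-decAt⇒gap (≼⇒≤* u≼y len-uy) r)))
  , cong (_ ∷_) chain

labels⇒coverSeq : ∀ {ls} → Word u → Word x → u ≤* x → ls ↭ M u x →
  Σ (List (List ℕ)) (λ vs → CoverSeq (x ∷ vs) × last (x ∷ vs) ≡ just u × labelsFrom x vs ≡ just ls)
labels⇒coverSeq {ls = []} _ wx u≤x ls↭
  with refl ← multisetFrom-≡[] 1 u≤x (↭-empty-inv (↭-sym ls↭)) = [] , one wx , refl , refl
labels⇒coverSeq {x = x} {ls = l ∷ ls} wu wx u≤x ls↭
  with (i , refl , g) ← ∈-multisetFrom 1 u≤x (∈-resp-↭ ls↭ (here refl))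
  with r ← gap⇒reducible wu g
  with (vs , rest , e , labels) ← labels⇒coverSeq wu (decAt-word wx r) (gap⇒≤*-decAt u≤x g)
                                    (drop-∷ (↭-trans ls↭ (multisetFrom-decAt 1 g)))
  = decAt x i ∷ vs , step (decAt-cover wx r) rest , e , labelsFrom-∷ (labelStep-decAt wx r) labels

maxChain-labels : (C : MaxChain u w) → length u ≡ length w →
  Σ (List ℕ) (λ ls → chainLabels C ≡ just ls × ls ↭ M u w × elems C ≡ w ∷ replay w ls)
maxChain-labels record { elems = [] ; top = () }
maxChain-labels record { elems = w ∷ _ ; covers = cs ; top = refl ; bottom = e } len
  with (ls , labels , ls↭ , chain) ← coverSeq-labels cs e len = ls , labels , ls↭ , cong (w ∷_) chain

maxChain-labels-injective : length u ≡ length w →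
  (C C′ : MaxChain u w) → chainLabels C ≡ chainLabels C′ → elems C ≡ elems C′
maxChain-labels-injective len C C′ same
  with (_ , labels , _ , chain) ← maxChain-labels C len
  with (_ , labels′ , _ , chain′) ← maxChain-labels C′ len
  with refl ← trans (sym labels) (trans same labels′)
  = trans chain (sym chain′)

labels⇒maxChain : ∀ {ls} → Word u → Word w → u ≤* w → ls ↭ M u w →
  Σ (MaxChain u w) (λ C → chainLabels C ≡ just ls)
labels⇒maxChain wu ww u≤w ls↭ with (vs , cs , e , labels) ← labels⇒coverSeq wu ww u≤w ls↭
  = record { elems = _ ∷ vs ; covers = cs ; top = refl ; bottom = e } , labels

lemma4p1 : (u w : List ℕ) → Word u → Word w → u ≼ w → length u ≡ length w →
    ((C : MaxChain u w) → Σ (List ℕ) (λ l → (chainLabels C ≡ just l) × (l ↭ M u w)))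
    × ((C C′ : MaxChain u w) → chainLabels C ≡ chainLabels C′ → elems C ≡ elems C′)
    × ((l : List ℕ) → l ↭ M u w → Σ (MaxChain u w) (λ C → chainLabels C ≡ just l))
    × (Σ ℕ (λ a → (a ∈ M u w) × All (λ b → b ≡ a) (M u w)) →
         Σ (MaxChain u w) (λ C → (C′ : MaxChain u w) → elems C′ ≡ elems C))
lemma4p1 u w wu ww u≼w len = labelled , maxChain-labels-injective len , surjective , unique
  where
  labelled : (C : MaxChain u w) → Σ (List ℕ) (λ l → (chainLabels C ≡ just l) × (l ↭ M u w))
  labelled C with (ls , labels , ls↭ , _) ← maxChain-labels C len = ls , labels , ls↭

  surjective : (l : List ℕ) → l ↭ M u w → Σ (MaxChain u w) (λ C → chainLabels C ≡ just l)
  surjective _ = labels⇒maxChain wu ww (≼⇒≤* u≼w len)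

  unique : Σ ℕ (λ a → (a ∈ M u w) × All (λ b → b ≡ a) (M u w)) →
           Σ (MaxChain u w) (λ C → (C′ : MaxChain u w) → elems C′ ≡ elems C)
  unique (_ , _ , all≡) with (C , labels) ← surjective (M u w) ↭-refl = C , λ C′ →
    maxChain-labels-injective len C′ C (trans (labels-are-M C′) (sym labels))
    where
    labels-are-M : (C′ : MaxChain u w) → chainLabels C′ ≡ just (M u w)
    labels-are-M C′ with (_ , labels′ , ls↭) ← labelled C′ = trans labels′ (cong just (↭-All≡⇒≡ all≡ ls↭))
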